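{- Let $A,B,C$ be thin groupoids, $S\in\mathbf{T}_{A\multimap B}$ and $T\in\mathbf{T}_{B\multimap C}$. Then $T\odot S\in\mathbf{T}_{A\multimap C}$.
   Context: All groupoids are small. Prestrategies. A prestrategy on $A$ is $(S,\partial^S:S\to A)$; one from $A$ to $B$ is a prestrategy on $A\times B$, with $\partial^S=\langle\partial^S_A,\partial^S_B\rangle$. Bipullbacks. For a cospan $S\xrightarrow{u}B\xleftarrow{v}T$: - a pseudocone with vertex $X$ is $(l',r',\nu:ul'\Rightarrow vr')$; - morphisms are $(\alpha,\beta)$ with $\nu''\circ u\alpha=v\beta\circ\nu$; - $(P,l,r,\mu)$ is a bipullback if for every $X$, $h\mapsto(lh,rh,\mu h)$ is an equivalence from functors $X\to P$ to pseudocones with vertex $X$; - commuting squares carry identity $2$-cells. Uniform structure. $S\perp T$ iff the pullback of $S\to B\leftarrow T$ is a bipullback, and $\mathbf{S}^\perp=\{T\mid\forall S\in\mathbf{S},S\perp T\}$. A uniform groupoid is $(A,\mathbf{U}_A)$ with $\mathbf{U}_A^{\perp\perp}=\mathbf{U}_A$. Thin structure. For $S\in\mathbf{U}_A$ and $T\in\mathbf{U}_A^\perp$, $S\perp_{\mathrm{th}}T$ iff the pullback of $S\to A\leftarrow T$ is discrete. $\mathbf{S}^{\perp_{\mathrm{th}}}$ is taken within $\mathbf{U}_A^\perp$ for $\mathbf{S}\subseteq\mathbf{U}_A$, and within $\mathbf{U}_A$ for subsets of $\mathbf{U}_A^\perp$. A thin groupoid is a groupoid $A$ with subgroupoids $A_-,A_+$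 containing all objects, a uniform structure $\mathbf{U}_A$, and $\mathbf{T}_A\subseteq\mathbf{U}_A$ with $\mathbf{T}_A^{\perp_{\mathrm{th}}\perp_{\mathrm{th}}}=\mathbf{T}_A$, $(A_-,\mathrm{incl})\in\mathbf{T}_A$ and $(A_+,\mathrm{incl})\in\mathbf{T}_A^{\perp_{\mathrm{th}}}$. Linear arrow. For thin $A,B$, $A\multimap B$ has: - underlying groupoid $A\times B$; - $(A\multimap B)_-=A_+\times B_-$ and $(A\multimap B)_+=A_-\times B_+$; - $\mathbf{U}_{A\multimap B}=\{(S\times U,\partial^S\times\partial^U)\mid S\in\mathbf{U}_A,U\in\mathbf{U}_B^\perp\}^\perp$; - $\mathbf{T}_{A\multimap B}=\{T\in\mathbf{U}_{A\multimap B}\mid$ the pullback of $T\to A\times B\leftarrow S\times U$ is discrete for all $S\in\mathbf{T}_A$ and $U\in\mathbf{T}_B^{\perp_{\mathrm{th}}}\}$. Composition. For $S$ from $A$ to $B$ and $T$ from $B$ to $C$, $T\odot S$ is the pullback $P$ of $S\xrightarrow{\partial^S_B}B\xleftarrow{\partial^T_B}T$ with projections $l,r$ and display $\langle\partial^S_Al,\partial^T_Cr\rangle$. -}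

module Defs where

open import Level using (Level)
open import Data.Product using (Σ; Σ-syntax; _×_; _,_; proj₁; proj₂)
open import Relation.Binary.PropositionalEquality
  using (_≡_; refl; sym; trans; cong; cong₂; module ≡-Reasoning)

record Groupoid : Set₁ where
  infixr 9 _∘_
  field
    Obj   : Set
    Hom   : Obj → Obj → Set
    id    : ∀ {x} → Hom x x
    _∘_   : ∀ {x y z} → Hom y z → Hom x y → Hom x z
    _⁻¹   : ∀ {x y} → Hom x y → Hom y x
    idˡ   : ∀ {x y} (f : Hom x y) → id ∘ f ≡ f
    idʳ   : ∀ {x y} (f : Hom x y) → f ∘ id ≡ f
    assoc : ∀ {w x y z} (h : Hom y z) (g : Hom x y) (f : Hom w x) →
            (h ∘ g) ∘ f ≡ h ∘ (g ∘ f)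
    invˡ  : ∀ {x y} (f : Hom x y) → (f ⁻¹) ∘ f ≡ id
    invʳ  : ∀ {x y} (f : Hom x y) → f ∘ (f ⁻¹) ≡ id

  coe : ∀ {x y} → x ≡ y → Hom x y
  coe refl = id

open Groupoid

uip : ∀ {a} {A : Set a} {x y : A} (p q : x ≡ y) → p ≡ q
uip refl refl = refl

record Functor (X Y : Groupoid) : Set where
  private
    module X = Groupoid X
    module Y = Groupoid Y
  field
    F₀   : X.Obj → Y.Obj
    F₁   : ∀ {x y} → X.Hom x y → Y.Hom (F₀ x) (F₀ y)
    F-id : ∀ {x} → F₁ (X.id {x}) ≡ Y.id
    F-∘  : ∀ {x y z} (g : X.Hom y z) (f : X.Hom x y) →
           F₁ (g X.∘ f) ≡ F₁ g Y.∘ F₁ f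

open Functor

_∘F_ : ∀ {X Y Z} → Functor Y Z → Functor X Y → Functor X Z
_∘F_ {X} {Y} {Z} G F = record
  { F₀ = λ x → F₀ G (F₀ F x)
  ; F₁ = λ f → F₁ G (F₁ F f)
  ; F-id = trans (cong (F₁ G) (F-id F)) (F-id G)
  ; F-∘ = λ g f → trans (cong (F₁ G) (F-∘ F g f)) (F-∘ G (F₁ F g) (F₁ F f))
  }

F-inv : ∀ {X Y} (F : Functor X Y) {x y} (f : Hom X x y) →
        _∘_ Y (F₁ F (_⁻¹ X f)) (F₁ F f) ≡ id Y
F-inv {X} {Y} F f = trans (sym (F-∘ F (_⁻¹ X f) f))
                          (trans (cong (F₁ F) (invˡ X f)) (F-id F))

-- Natural transformations (automatically natural isomorphisms)

record NatTrans {X Y : Groupoid} (F G : Functor X Y) : Set where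
  field
    η   : ∀ x → Hom Y (F₀ F x) (F₀ G x)
    nat : ∀ {x y} (f : Hom X x y) →
          _∘_ Y (η y) (F₁ F f) ≡ _∘_ Y (F₁ G f) (η x)

open NatTrans

_⊗_ : Groupoid → Groupoid → Groupoid
A ⊗ B = record
  { Obj = Obj A × Obj B
  ; Hom = λ p q → Hom A (proj₁ p) (proj₁ q) × Hom B (proj₂ p) (proj₂ q)
  ; id = id A , id B
  ; _∘_ = λ g f → _∘_ A (proj₁ g) (proj₁ f) , _∘_ B (proj₂ g) (proj₂ f)
  ; _⁻¹ = λ f → _⁻¹ A (proj₁ f) , _⁻¹ B (proj₂ f)
  ; idˡ = λ f → cong₂ _,_ (idˡ A (proj₁ f)) (idˡ B (proj₂ f))
  ; idʳ = λ f → cong₂ _,_ (idʳ A (proj₁ f)) (idʳ B (proj₂ f))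
  ; assoc = λ h g f → cong₂ _,_ (assoc A (proj₁ h) (proj₁ g) (proj₁ f))
                                 (assoc B (proj₂ h) (proj₂ g) (proj₂ f))
  ; invˡ = λ f → cong₂ _,_ (invˡ A (proj₁ f)) (invˡ B (proj₂ f))
  ; invʳ = λ f → cong₂ _,_ (invʳ A (proj₁ f)) (invʳ B (proj₂ f))
  }

π₁ : ∀ {A B} → Functor (A ⊗ B) A
π₁ = record { F₀ = proj₁ ; F₁ = proj₁ ; F-id = refl ; F-∘ = λ _ _ → refl }

π₂ : ∀ {A B} → Functor (A ⊗ B) B
π₂ = record { F₀ = proj₂ ; F₁ = proj₂ ; F-id = refl ; F-∘ = λ _ _ → refl }

⟨_,_⟩F : ∀ {X A B} → Functor X A → Functor X B → Functor X (A ⊗ B)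
⟨ F , G ⟩F = record
  { F₀ = λ x → F₀ F x , F₀ G x
  ; F₁ = λ f → F₁ F f , F₁ G f
  ; F-id = cong₂ _,_ (F-id F) (F-id G)
  ; F-∘ = λ g f → cong₂ _,_ (F-∘ F g f) (F-∘ G g f)
  }

_×F_ : ∀ {X Y A B} → Functor X A → Functor Y B → Functor (X ⊗ Y) (A ⊗ B)
F ×F G = ⟨ F ∘F π₁ , G ∘F π₂ ⟩F

module _ {S B T : Groupoid} (u : Functor S B) (v : Functor T B) where
  private
    module S = Groupoid S
    module B = Groupoid B
    module T = Groupoid T
    open ≡-Reasoning

  PbObj : Set
  PbObj = Σ[ s ∈ S.Obj ] Σ[ t ∈ T.Obj ] (F₀ u s ≡ F₀ v t)

  record PbHom (p q : PbObj) : Set where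
    constructor pbhom
    field
      hf : S.Hom (proj₁ p) (proj₁ q)
      hg : T.Hom (proj₁ (proj₂ p)) (proj₁ (proj₂ q))
      sq : B.coe (proj₂ (proj₂ q)) B.∘ F₁ u hf ≡ F₁ v hg B.∘ B.coe (proj₂ (proj₂ p))

  open PbHom

  private
    pb-≡ : ∀ {p q} {a b : PbHom p q} →
           hf a ≡ hf b → hg a ≡ hg b → a ≡ b
    pb-≡ {a = pbhom f g x} {b = pbhom .f .g y} refl refl = cong (pbhom f g) (uip x y)

    pb-id : ∀ {p} → PbHom p p
    pb-id {s , t , e} = pbhom S.id T.id (begin
      B.coe e B.∘ F₁ u S.id ≡⟨ cong (B.coe e B.∘_) (F-id u) ⟩
      B.coe e B.∘ B.id      ≡⟨ B.idʳ _ ⟩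
      B.coe e               ≡⟨ sym (B.idˡ _) ⟩
      B.id B.∘ B.coe e      ≡⟨ cong (B._∘ B.coe e) (sym (F-id v)) ⟩
      F₁ v T.id B.∘ B.coe e ∎)

    pb-∘ : ∀ {p q r} → PbHom q r → PbHom p q → PbHom p r
    pb-∘ {s , t , e} {s' , t' , e'} {s'' , t'' , e''} (pbhom f' g' x') (pbhom f g x) =
      pbhom (f' S.∘ f) (g' T.∘ g) (begin
        B.coe e'' B.∘ F₁ u (f' S.∘ f)
          ≡⟨ cong (B.coe e'' B.∘_) (F-∘ u f' f) ⟩
        B.coe e'' B.∘ (F₁ u f' B.∘ F₁ u f)
          ≡⟨ sym (B.assoc _ _ _) ⟩
        (B.coe e'' B.∘ F₁ u f') B.∘ F₁ u f
          ≡⟨ cong (B._∘ F₁ u f) x' ⟩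
        (F₁ v g' B.∘ B.coe e') B.∘ F₁ u f
          ≡⟨ B.assoc _ _ _ ⟩
        F₁ v g' B.∘ (B.coe e' B.∘ F₁ u f)
          ≡⟨ cong (F₁ v g' B.∘_) x ⟩
        F₁ v g' B.∘ (F₁ v g B.∘ B.coe e)
          ≡⟨ sym (B.assoc _ _ _) ⟩
        (F₁ v g' B.∘ F₁ v g) B.∘ B.coe e
          ≡⟨ cong (B._∘ B.coe e) (sym (F-∘ v g' g)) ⟩
        F₁ v (g' T.∘ g) B.∘ B.coe e ∎)

    pb-inv : ∀ {p q} → PbHom p q → PbHom q p
    pb-inv {s , t , e} {s' , t' , e'} (pbhom f g x) =
      pbhom (f S.⁻¹) (g T.⁻¹) (begin
        B.coe e B.∘ F₁ u (f S.⁻¹)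
          ≡⟨ sym (B.idˡ _) ⟩
        B.id B.∘ (B.coe e B.∘ F₁ u (f S.⁻¹))
          ≡⟨ cong (B._∘ (B.coe e B.∘ F₁ u (f S.⁻¹))) (sym (F-inv v g)) ⟩
        (F₁ v (g T.⁻¹) B.∘ F₁ v g) B.∘ (B.coe e B.∘ F₁ u (f S.⁻¹))
          ≡⟨ B.assoc _ _ _ ⟩
        F₁ v (g T.⁻¹) B.∘ (F₁ v g B.∘ (B.coe e B.∘ F₁ u (f S.⁻¹)))
          ≡⟨ cong (F₁ v (g T.⁻¹) B.∘_) (sym (B.assoc _ _ _)) ⟩
        F₁ v (g T.⁻¹) B.∘ ((F₁ v g B.∘ B.coe e) B.∘ F₁ u (f S.⁻¹))
          ≡⟨ cong (λ z → F₁ v (g T.⁻¹) B.∘ (z B.∘ F₁ u (f S.⁻¹))) (sym x) ⟩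
        F₁ v (g T.⁻¹) B.∘ ((B.coe e' B.∘ F₁ u f) B.∘ F₁ u (f S.⁻¹))
          ≡⟨ cong (F₁ v (g T.⁻¹) B.∘_) (B.assoc _ _ _) ⟩
        F₁ v (g T.⁻¹) B.∘ (B.coe e' B.∘ (F₁ u f B.∘ F₁ u (f S.⁻¹)))
          ≡⟨ cong (λ z → F₁ v (g T.⁻¹) B.∘ (B.coe e' B.∘ z))
                  (trans (sym (F-∘ u f (f S.⁻¹)))
                         (trans (cong (F₁ u) (S.invʳ f)) (F-id u))) ⟩
        F₁ v (g T.⁻¹) B.∘ (B.coe e' B.∘ B.id)
          ≡⟨ cong (F₁ v (g T.⁻¹) B.∘_) (B.idʳ _) ⟩
        F₁ v (g T.⁻¹) B.∘ B.coe e' ∎)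

  Pullback : Groupoid
  Pullback = record
    { Obj = PbObj
    ; Hom = PbHom
    ; id = pb-id
    ; _∘_ = pb-∘
    ; _⁻¹ = pb-inv
    ; idˡ = λ f → pb-≡ (S.idˡ _) (T.idˡ _)
    ; idʳ = λ f → pb-≡ (S.idʳ _) (T.idʳ _)
    ; assoc = λ h g f → pb-≡ (S.assoc _ _ _) (T.assoc _ _ _)
    ; invˡ = λ f → pb-≡ (S.invˡ _) (T.invˡ _)
    ; invʳ = λ f → pb-≡ (S.invʳ _) (T.invʳ _)
    }

  pb-l : Functor Pullback S
  pb-l = record { F₀ = proj₁ ; F₁ = hf ; F-id = refl ; F-∘ = λ _ _ → refl }

  pb-r : Functor Pullback T
  pb-r = record { F₀ = λ p → proj₁ (proj₂ p) ; F₁ = hg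
                ; F-id = refl ; F-∘ = λ _ _ → refl }

  pb-μ : NatTrans (u ∘F pb-l) (v ∘F pb-r)
  pb-μ = record { η = λ p → B.coe (proj₂ (proj₂ p))
                ; nat = sq }

module _ {S B T : Groupoid} (u : Functor S B) (v : Functor T B) where
  private
    module B = Groupoid B

  record Pseudocone (X : Groupoid) : Set where
    field
      l' : Functor X S
      r' : Functor X T
      ν  : NatTrans (u ∘F l') (v ∘F r')

  open Pseudocone

  record PseudoconeMor {X : Groupoid} (c c' : Pseudocone X) : Set where
    field
      α  : NatTrans (l' c) (l' c')
      β  : NatTrans (r' c) (r' c')
      eq : ∀ x → η (ν c') x B.∘ F₁ u (η α x) ≡ F₁ v (η β x) B.∘ η (ν c) x

  open PseudoconeMor

  module _ {P : Groupoid} (l : Functor P S) (r : Functor P T)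
           (μ : NatTrans (u ∘F l) (v ∘F r)) where

    coneOf : ∀ {X} → Functor X P → Pseudocone X
    coneOf h = record
      { l' = l ∘F h ; r' = r ∘F h
      ; ν = record { η = λ x → η μ (F₀ h x) ; nat = λ f → nat μ (F₁ h f) } }

    -- The functor  [X , P] → Pseudocones(X)  is an equivalence of
    -- groupoids: (split) essentially surjective, full and faithful.
    -- Morphisms of [X , P] are natural transformations, compared
    -- componentwise; morphisms of pseudocones likewise.
    EssSurj : Groupoid → Set
    EssSurj X = ∀ (c : Pseudocone X) →
      Σ[ h ∈ Functor X P ] PseudoconeMor (coneOf h) c

    Full : Groupoid → Set
    Full X = ∀ (h h' : Functor X P) (m : PseudoconeMor (coneOf h) (coneOf h')) →
      Σ[ γ ∈ NatTrans h h' ]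
        ((∀ x → F₁ l (η γ x) ≡ η (α m) x) × (∀ x → F₁ r (η γ x) ≡ η (β m) x))

    Faithful : Groupoid → Set
    Faithful X = ∀ (h h' : Functor X P) (γ γ' : NatTrans h h') →
      (∀ x → F₁ l (η γ x) ≡ F₁ l (η γ' x)) →
      (∀ x → F₁ r (η γ x) ≡ F₁ r (η γ' x)) →
      ∀ x → η γ x ≡ η γ' x

    IsBipullback : Set₁
    IsBipullback = ∀ (X : Groupoid) → EssSurj X × Full X × Faithful X

record Prestrategy (A : Groupoid) : Set₁ where
  constructor prestrategy
  field
    carrier : Groupoid
    ∂       : Functor carrier A

open Prestrategy

PSet : Groupoid → Set₂
PSet A = Prestrategy A → Set₁

PB : ∀ {A} → Prestrategy A → Prestrategy A → Groupoid
PB S T = Pullback (∂ S) (∂ T)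

_⊥_ : ∀ {A} → Prestrategy A → Prestrategy A → Set₁
S ⊥ T = IsBipullback (∂ S) (∂ T) (pb-l (∂ S) (∂ T)) (pb-r (∂ S) (∂ T)) (pb-μ (∂ S) (∂ T))

_^⊥ : ∀ {A} → PSet A → PSet A
(𝐒 ^⊥) T = ∀ S → 𝐒 S → S ⊥ T

Discrete : Groupoid → Set
Discrete G = ∀ {x y} (f : Hom G x y) → Σ[ p ∈ x ≡ y ] (coe G p ≡ f)

record WideSub (A : Groupoid) : Set₁ where
  field
    mem    : ∀ {x y} → Hom A x y → Set
    mem-prop : ∀ {x y} {f : Hom A x y} (p q : mem f) → p ≡ q
    mem-id : ∀ {x} → mem (id A {x})
    mem-∘  : ∀ {x y z} {g : Hom A y z} {f : Hom A x y} →
             mem g → mem f → mem (_∘_ A g f)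
    mem-⁻¹ : ∀ {x y} {f : Hom A x y} → mem f → mem (_⁻¹ A f)

open WideSub

module _ {A : Groupoid} (W : WideSub A) where
  private
    sub-≡ : ∀ {x y} {a b : Σ[ f ∈ Hom A x y ] mem W f} → proj₁ a ≡ proj₁ b → a ≡ b
    sub-≡ {a = f , p} {b = .f , q} refl = cong (f ,_) (mem-prop W p q)

  subGroupoid : Groupoid
  subGroupoid = record
    { Obj = Obj A
    ; Hom = λ x y → Σ[ f ∈ Hom A x y ] mem W f
    ; id = id A , mem-id W
    ; _∘_ = λ g f → _∘_ A (proj₁ g) (proj₁ f) , mem-∘ W (proj₂ g) (proj₂ f)
    ; _⁻¹ = λ f → _⁻¹ A (proj₁ f) , mem-⁻¹ W (proj₂ f)
    ; idˡ = λ f → sub-≡ (idˡ A _)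
    ; idʳ = λ f → sub-≡ (idʳ A _)
    ; assoc = λ h g f → sub-≡ (assoc A _ _ _)
    ; invˡ = λ f → sub-≡ (invˡ A _)
    ; invʳ = λ f → sub-≡ (invʳ A _)
    }

  incl : Functor subGroupoid A
  incl = record { F₀ = λ x → x ; F₁ = proj₁ ; F-id = refl ; F-∘ = λ _ _ → refl }

  subStrat : Prestrategy A
  subStrat = prestrategy subGroupoid incl

module _ {A : Groupoid} (U : PSet A) where
  -- for 𝐒 ⊆ U : taken within U^⊥
  _^⊥th⁺ : PSet A → PSet A
  (𝐒 ^⊥th⁺) T = (U ^⊥) T × (∀ S → 𝐒 S → Discrete (PB S T))

  -- for 𝐓 ⊆ U^⊥ : taken within U
  _^⊥th⁻ : PSet A → PSet A
  (𝐓 ^⊥th⁻) S = U S × (∀ T → 𝐓 T → Discrete (PB S T))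

record Thin : Set₂ where
  field
    G      : Groupoid
    minus  : WideSub G
    plus   : WideSub G
    U      : PSet G
    U-⊥⊥   : ∀ S → ((U ^⊥) ^⊥) S → U S
    U-⊥⊥'  : ∀ S → U S → ((U ^⊥) ^⊥) S
    𝐓      : PSet G
    𝐓⊆U    : ∀ S → 𝐓 S → U S
    𝐓-⊥⊥   : ∀ S → _^⊥th⁻ U (_^⊥th⁺ U 𝐓) S → 𝐓 S
    𝐓-⊥⊥'  : ∀ S → 𝐓 S → _^⊥th⁻ U (_^⊥th⁺ U 𝐓) S
    minus∈ : 𝐓 (subStrat minus)
    plus∈  : _^⊥th⁺ U 𝐓 (subStrat plus)

open Thin

-- The linear arrow A ⊸ B (only the parts needed: U and T)

_⊗S_ : ∀ {A B} → Prestrategy A → Prestrategy B → Prestrategy (A ⊗ B)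
S ⊗S V = prestrategy (carrier S ⊗ carrier V) (∂ S ×F ∂ V)

U⊸ : (A B : Thin) → PSet (G A ⊗ G B)
U⊸ A B W = ∀ S → U A S → ∀ V → (U B ^⊥) V → (S ⊗S V) ⊥ W

T⊸ : (A B : Thin) → PSet (G A ⊗ G B)
T⊸ A B W = U⊸ A B W ×
  (∀ S → 𝐓 A S → ∀ V → _^⊥th⁺ (U B) (𝐓 B) V → Discrete (PB W (S ⊗S V)))

_⊙_ : ∀ {A B C} → Prestrategy (B ⊗ C) → Prestrategy (A ⊗ B) → Prestrategy (A ⊗ C)
T ⊙ S = prestrategy P ⟨ (π₁ ∘F ∂ S) ∘F l , (π₂ ∘F ∂ T) ∘F r ⟩F
  where
    P = Pullback (π₂ ∘F ∂ S) (π₁ ∘F ∂ T)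
    l = pb-l (π₂ ∘F ∂ S) (π₁ ∘F ∂ T)
    r = pb-r (π₂ ∘F ∂ S) (π₁ ∘F ∂ T)

{-# OPTIONS --safe #-}
module Submission where

-- The strict pullback of u and v is a bipullback exactly when every
-- morphism β : u s → v t is rectifiable: isomorphic, through isomorphisms
-- of s and t, to an identity u s' = v t'.  Write S · σ for the prestrategy
-- on B obtained by playing σ ∈ U_A against S.  Pullbacks paste, so the
-- interaction of S · σ with V is the interaction of S with σ ⊗ V, and that
-- of T ⊙ S with σ ⊗ W is the interaction of T with (S · σ) ⊗ W.
-- Rectifiability and discreteness transfer along these identifications;
-- biorthogonality closure then puts S · σ into U_B (into T_B when σ ∈ T_A),
-- and the hypothesis on T yields the claim for T ⊙ S.

open import Defs
open import Data.Product using (Σ-syntax; _,_; proj₁; proj₂)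
open import Data.Unit using (⊤; tt)
open import Relation.Binary.PropositionalEquality
  using (_≡_; refl; sym; trans; cong; cong₂; module ≡-Reasoning)

open Groupoid using (Obj; Hom; coe)
open Functor using (F₀; F₁; F-id; F-∘)
open NatTrans using (η; nat)
open Prestrategy using (carrier; ∂)

module Squares (G : Groupoid) where
  open Groupoid G hiding (Obj; Hom; coe)
  open ≡-Reasoning

  cancelˡ : ∀ {x y z} (p : Hom G y z) (q : Hom G x y) → (p ⁻¹) ∘ (p ∘ q) ≡ q
  cancelˡ p q = trans (sym (assoc _ _ _)) (trans (cong (_∘ q) (invˡ p)) (idˡ q))

  cancelʳ : ∀ {x y z} (g : Hom G x z) (k : Hom G x y) → (g ∘ (k ⁻¹)) ∘ k ≡ g
  cancelʳ g k = trans (assoc _ _ _) (trans (cong (g ∘_) (invˡ k)) (idʳ g))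

  square-transpose : ∀ {x x' y y'} {a : Hom G x x'} {b : Hom G y y'}
                     {c : Hom G x' y'} {d : Hom G x y} →
                     c ∘ a ≡ b ∘ d → d ∘ (a ⁻¹) ≡ (b ⁻¹) ∘ c
  square-transpose {a = a} {b} {c} {d} h = begin
    d ∘ (a ⁻¹)                  ≡⟨ sym (cancelˡ b _) ⟩
    (b ⁻¹) ∘ (b ∘ (d ∘ (a ⁻¹))) ≡⟨ cong ((b ⁻¹) ∘_) (sym (assoc _ _ _)) ⟩
    (b ⁻¹) ∘ ((b ∘ d) ∘ (a ⁻¹)) ≡⟨ cong (λ z → (b ⁻¹) ∘ (z ∘ (a ⁻¹))) (sym h) ⟩
    (b ⁻¹) ∘ ((c ∘ a) ∘ (a ⁻¹)) ≡⟨ cong ((b ⁻¹) ∘_) (assoc _ _ _) ⟩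
    (b ⁻¹) ∘ (c ∘ (a ∘ (a ⁻¹))) ≡⟨ cong (λ z → (b ⁻¹) ∘ (c ∘ z)) (invʳ a) ⟩
    (b ⁻¹) ∘ (c ∘ id)           ≡⟨ cong ((b ⁻¹) ∘_) (idʳ c) ⟩
    (b ⁻¹) ∘ c                  ∎

  square-paste : ∀ {a b c a' b' c'} {x : Hom G a a'} {y : Hom G b b'} {z : Hom G c c'}
                 {f : Hom G a b} {g : Hom G a' b'} {f' : Hom G b c} {g' : Hom G b' c'} →
                 y ∘ f ≡ g ∘ x → z ∘ f' ≡ g' ∘ y → z ∘ (f' ∘ f) ≡ (g' ∘ g) ∘ x
  square-paste {x = x} {y} {z} {f} {g} {f'} {g'} h₁ h₂ = begin
    z ∘ (f' ∘ f)  ≡⟨ sym (assoc _ _ _) ⟩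
    (z ∘ f') ∘ f  ≡⟨ cong (_∘ f) h₂ ⟩
    (g' ∘ y) ∘ f  ≡⟨ assoc _ _ _ ⟩
    g' ∘ (y ∘ f)  ≡⟨ cong (g' ∘_) h₁ ⟩
    g' ∘ (g ∘ x)  ≡⟨ sym (assoc _ _ _) ⟩
    (g' ∘ g) ∘ x  ∎

  square-cancel-inv : ∀ {a b c d e} {z : Hom G c d} {f : Hom G b c} {g : Hom G e d}
                      {h : Hom G a e} {k : Hom G a b} →
                      z ∘ f ≡ g ∘ (h ∘ (k ⁻¹)) → z ∘ (f ∘ k) ≡ g ∘ h
  square-cancel-inv {z = z} {f} {g} {h} {k} eq = begin
    z ∘ (f ∘ k)             ≡⟨ sym (assoc _ _ _) ⟩
    (z ∘ f) ∘ k             ≡⟨ cong (_∘ k) eq ⟩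
    (g ∘ (h ∘ (k ⁻¹))) ∘ k  ≡⟨ assoc _ _ _ ⟩
    g ∘ ((h ∘ (k ⁻¹)) ∘ k)  ≡⟨ cong (g ∘_) (cancelʳ h k) ⟩
    g ∘ h                   ∎

  coe-square-invert : ∀ {w x y z} {p : y ≡ z} {f : Hom G w y} {g : Hom G x z}
                      {k : Hom G x w} →
                      coe G p ∘ f ≡ g ∘ (k ⁻¹) → coe G (sym p) ∘ g ≡ f ∘ k
  coe-square-invert {p = refl} {f} {g} {k} h = begin
    id ∘ g              ≡⟨ idˡ g ⟩
    g                   ≡⟨ sym (cancelʳ g k) ⟩
    (g ∘ (k ⁻¹)) ∘ k    ≡⟨ cong (_∘ k) (sym h) ⟩
    (id ∘ f) ∘ k        ≡⟨ cong (_∘ k) (idˡ f) ⟩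
    f ∘ k               ∎

  coe-square-sym : ∀ {x y x' y'} {p : x ≡ y} {p' : x' ≡ y'}
                   {f : Hom G x x'} {g : Hom G y y'} →
                   coe G p' ∘ f ≡ g ∘ coe G p → coe G (sym p') ∘ g ≡ f ∘ coe G (sym p)
  coe-square-sym {p = refl} {refl} {f} {g} h =
    trans (idˡ g) (trans (sym (idʳ g)) (trans (sym h) (trans (idˡ f) (sym (idʳ f)))))

  conj : ∀ {x x' y y'} → Hom G x x' → Hom G y y' → Hom G x y → Hom G x' y'
  conj p q f = q ∘ (f ∘ (p ⁻¹))

  conj-id : ∀ {x x'} (p : Hom G x x') → conj p p id ≡ id
  conj-id p = trans (cong (p ∘_) (idˡ _)) (invʳ p)

  conj-∘ : ∀ {x y z x' y' z'} (px : Hom G x x') (py : Hom G y y') (pz : Hom G z z')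
           (g : Hom G y z) (f : Hom G x y) →
           conj px pz (g ∘ f) ≡ conj py pz g ∘ conj px py f
  conj-∘ px py pz g f = sym (begin
    (pz ∘ (g ∘ (py ⁻¹))) ∘ (py ∘ (f ∘ (px ⁻¹)))  ≡⟨ assoc _ _ _ ⟩
    pz ∘ ((g ∘ (py ⁻¹)) ∘ (py ∘ (f ∘ (px ⁻¹))))  ≡⟨ cong (pz ∘_) (assoc _ _ _) ⟩
    pz ∘ (g ∘ ((py ⁻¹) ∘ (py ∘ (f ∘ (px ⁻¹)))))  ≡⟨ cong (λ w → pz ∘ (g ∘ w)) (cancelˡ py _) ⟩
    pz ∘ (g ∘ (f ∘ (px ⁻¹)))                      ≡⟨ cong (pz ∘_) (sym (assoc _ _ _)) ⟩
    pz ∘ ((g ∘ f) ∘ (px ⁻¹))                      ∎)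

F-⁻¹ : ∀ {X Y} (F : Functor X Y) {x y} (f : Hom X x y) →
       F₁ F (Groupoid._⁻¹ X f) ≡ Groupoid._⁻¹ Y (F₁ F f)
F-⁻¹ {X} {Y} F f = begin
  F₁ F (f X.⁻¹)                                 ≡⟨ sym (Y.idʳ _) ⟩
  F₁ F (f X.⁻¹) Y.∘ Y.id                        ≡⟨ cong (F₁ F (f X.⁻¹) Y.∘_) (sym (Y.invʳ (F₁ F f))) ⟩
  F₁ F (f X.⁻¹) Y.∘ (F₁ F f Y.∘ (F₁ F f Y.⁻¹))  ≡⟨ sym (Y.assoc _ _ _) ⟩
  (F₁ F (f X.⁻¹) Y.∘ F₁ F f) Y.∘ (F₁ F f Y.⁻¹)  ≡⟨ cong (Y._∘ (F₁ F f Y.⁻¹)) (F-inv F f) ⟩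
  Y.id Y.∘ (F₁ F f Y.⁻¹)                        ≡⟨ Y.idˡ _ ⟩
  F₁ F f Y.⁻¹                                   ∎
  where
    module X = Groupoid X
    module Y = Groupoid Y
    open ≡-Reasoning

PbHom-≡ : ∀ {S B T} {u : Functor S B} {v : Functor T B} {p q} {a b : PbHom u v p q} →
          PbHom.hf a ≡ PbHom.hf b → PbHom.hg a ≡ PbHom.hg b → a ≡ b
PbHom-≡ {a = pbhom f g x} {b = pbhom .f .g y} refl refl = cong (pbhom f g) (uip x y)

PbObj-≡ : ∀ {S B T} {u : Functor S B} {v : Functor T B} {s s' t t'}
          {e : F₀ u s ≡ F₀ v t} {e' : F₀ u s' ≡ F₀ v t'} →
          s ≡ s' → t ≡ t' → _≡_ {A = PbObj u v} (s , t , e) (s' , t' , e')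
PbObj-≡ {e = e} {e'} refl refl = cong (λ z → _ , _ , z) (uip e e')

module _ {A B : Groupoid} where
  private
    module A = Groupoid A
    module B = Groupoid B
    module A⊗B = Groupoid (A ⊗ B)

  ⊗-square₁ : ∀ {x y y'} {e : y ≡ y'} {f : Hom (A ⊗ B) x y} {g : Hom (A ⊗ B) x y'} →
              coe (A ⊗ B) e A⊗B.∘ f ≡ g → coe A (cong proj₁ e) A.∘ proj₁ f ≡ proj₁ g
  ⊗-square₁ {e = refl} h = cong proj₁ h

  ⊗-square₂ : ∀ {x y y'} {e : y ≡ y'} {f : Hom (A ⊗ B) x y} {g : Hom (A ⊗ B) x y'} →
              coe (A ⊗ B) e A⊗B.∘ f ≡ g → coe B (cong proj₂ e) B.∘ proj₂ f ≡ proj₂ g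
  ⊗-square₂ {e = refl} h = cong proj₂ h

  ⊗-square : ∀ {a a' b b' c d} {p : a' ≡ c} {q : b' ≡ d}
             {f₁ : Hom A a a'} {g₁ : Hom A a c} {f₂ : Hom B b b'} {g₂ : Hom B b d} →
             coe A p A.∘ f₁ ≡ g₁ → coe B q B.∘ f₂ ≡ g₂ →
             coe (A ⊗ B) (cong₂ _,_ p q) A⊗B.∘ (f₁ , f₂) ≡ (g₁ , g₂)
  ⊗-square {p = refl} {refl} h₁ h₂ = cong₂ _,_ h₁ h₂

  ⊗-coe-square₁ : ∀ {x y x' y'} {e : x ≡ y} {e' : x' ≡ y'}
                  {f : Hom (A ⊗ B) x x'} {g : Hom (A ⊗ B) y y'} →
                  coe (A ⊗ B) e' A⊗B.∘ f ≡ g A⊗B.∘ coe (A ⊗ B) e →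
                  coe A (cong proj₁ e') A.∘ proj₁ f ≡ proj₁ g A.∘ coe A (cong proj₁ e)
  ⊗-coe-square₁ {e = refl} {e'} = ⊗-square₁ {e = e'}

  ⊗-coe-square₂ : ∀ {x y x' y'} {e : x ≡ y} {e' : x' ≡ y'}
                  {f : Hom (A ⊗ B) x x'} {g : Hom (A ⊗ B) y y'} →
                  coe (A ⊗ B) e' A⊗B.∘ f ≡ g A⊗B.∘ coe (A ⊗ B) e →
                  coe B (cong proj₂ e') B.∘ proj₂ f ≡ proj₂ g B.∘ coe B (cong proj₂ e)
  ⊗-coe-square₂ {e = refl} {e'} = ⊗-square₂ {e = e'}

  ⊗-coe-square : ∀ {a a' c c' b b' d d'} {p : a ≡ c} {p' : a' ≡ c'} {q : b ≡ d} {q' : b' ≡ d'}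
                 {f₁ : Hom A a a'} {g₁ : Hom A c c'} {f₂ : Hom B b b'} {g₂ : Hom B d d'} →
                 coe A p' A.∘ f₁ ≡ g₁ A.∘ coe A p → coe B q' B.∘ f₂ ≡ g₂ B.∘ coe B q →
                 coe (A ⊗ B) (cong₂ _,_ p' q') A⊗B.∘ (f₁ , f₂)
                   ≡ (g₁ , g₂) A⊗B.∘ coe (A ⊗ B) (cong₂ _,_ p q)
  ⊗-coe-square {p = refl} {p'} {refl} {q'} = ⊗-square {p = p'} {q = q'}

discrete-transfer : ∀ {G H : Groupoid} (m₀ : Obj G → Obj H)
  (m₁ : ∀ {x y} → Hom G x y → Hom H (m₀ x) (m₀ y)) →
  (∀ {x y} → m₀ x ≡ m₀ y → x ≡ y) →
  (∀ {x} (f : Hom G x x) → m₁ f ≡ Groupoid.id H → f ≡ Groupoid.id G) →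
  Discrete H → Discrete G
discrete-transfer {G} {H} m₀ m₁ inj reflects-id D f = lift (inj (proj₁ (D (m₁ f)))) f
  where
    coe-loop : ∀ {x} (p : x ≡ x) {g : Hom H x x} → coe H p ≡ g → g ≡ Groupoid.id H
    coe-loop refl c = sym c

    lift : ∀ {x y} (p : x ≡ y) (f : Hom G x y) → Σ[ p ∈ x ≡ y ] (coe G p ≡ f)
    lift refl f = refl , sym (reflects-id f (coe-loop (proj₁ (D (m₁ f))) (proj₂ (D (m₁ f)))))

module _ {S B T : Groupoid} (u : Functor S B) (v : Functor T B) where
  private
    module B = Groupoid B

  record Rectification (s : Obj S) (t : Obj T) (β : Hom B (F₀ u s) (F₀ v t)) : Set where
    constructor rectification
    field
      s' : Obj S
      t' : Obj T
      e  : F₀ u s' ≡ F₀ v t'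
      φ  : Hom S s s'
      ψ  : Hom T t t'
      sq : coe B e B.∘ F₁ u φ ≡ F₁ v ψ B.∘ β

  Rectifiable : Set
  Rectifiable = ∀ s t β → Rectification s t β

𝟙 : Groupoid
𝟙 = record
  { Obj = ⊤ ; Hom = λ _ _ → ⊤ ; id = tt ; _∘_ = λ _ _ → tt ; _⁻¹ = λ _ → tt
  ; idˡ = λ _ → refl ; idʳ = λ _ → refl ; assoc = λ _ _ _ → refl
  ; invˡ = λ _ → refl ; invʳ = λ _ → refl }

const : ∀ {Y : Groupoid} → Obj Y → Functor 𝟙 Y
const {Y} y = record
  { F₀ = λ _ → y ; F₁ = λ _ → Groupoid.id Y ; F-id = refl
  ; F-∘ = λ _ _ → sym (Groupoid.idˡ Y _) }

module _ {S B T : Groupoid} {u : Functor S B} {v : Functor T B} where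
  private
    module S = Groupoid S
    module B = Groupoid B
    module T = Groupoid T
    module SqB = Squares B
    open Pseudocone
    open PseudoconeMor

  pullback-full : ∀ X → Full u v (pb-l u v) (pb-r u v) (pb-μ u v) X
  pullback-full X h h' m = γ , (λ _ → refl) , (λ _ → refl)
    where
      γ : NatTrans h h'
      γ = record
        { η = λ x → pbhom (η (α m) x) (η (β m) x) (eq m x)
        ; nat = λ f → PbHom-≡ (nat (α m) f) (nat (β m) f) }

  pullback-faithful : ∀ X → Faithful u v (pb-l u v) (pb-r u v) (pb-μ u v) X
  pullback-faithful X h h' γ γ' p q x = PbHom-≡ (p x) (q x)

  -- Rectify each component of the pseudocone; conjugating l' and r' by the
  -- rectifying isomorphisms gives a functor into the strict pullback.
  rectifiable⇒essSurj : Rectifiable u v → ∀ X → EssSurj u v (pb-l u v) (pb-r u v) (pb-μ u v) X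
  rectifiable⇒essSurj R X c = h , record
    { α  = record { η = λ x → φ x S.⁻¹ ; nat = λ {x} {y} f → SqS.cancelˡ (φ y) _ }
    ; β  = record { η = λ x → ψ x T.⁻¹ ; nat = λ {x} {y} f → SqT.cancelˡ (ψ y) _ }
    ; eq = transposed }
    where
      module X = Groupoid X
      module SqS = Squares S
      module SqT = Squares T
      module Rect (x : X.Obj) = Rectification (R (F₀ (l' c) x) (F₀ (r' c) x) (η (ν c) x))
      open Rect

      transposed : ∀ x → η (ν c) x B.∘ F₁ u (φ x S.⁻¹) ≡ F₁ v (ψ x T.⁻¹) B.∘ coe B (e x)
      transposed x = trans (cong (η (ν c) x B.∘_) (F-⁻¹ u (φ x)))
                      (trans (SqB.square-transpose (sq x))
                        (cong (B._∘ coe B (e x)) (sym (F-⁻¹ v (ψ x)))))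

      F-conj : ∀ {G} (F : Functor G B) {x x' y y'} (p : Hom G x x') (q : Hom G y y') (f : Hom G x y) →
               F₁ F (Squares.conj G p q f) ≡ F₁ F q B.∘ (F₁ F f B.∘ F₁ F (Groupoid._⁻¹ G p))
      F-conj F p q f = trans (F-∘ F _ _) (cong (F₁ F q B.∘_) (F-∘ F _ _))

      conj-square : ∀ {x y} (f : X.Hom x y) →
        coe B (e y) B.∘ F₁ u (SqS.conj (φ x) (φ y) (F₁ (l' c) f))
          ≡ F₁ v (SqT.conj (ψ x) (ψ y) (F₁ (r' c) f)) B.∘ coe B (e x)
      conj-square {x} {y} f =
        trans (cong (coe B (e y) B.∘_) (F-conj u _ _ _))
          (trans (SqB.square-paste (SqB.square-paste (transposed x) (nat (ν c) f)) (sq y))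
            (cong (B._∘ coe B (e x)) (sym (F-conj v _ _ _))))

      h : Functor X (Pullback u v)
      h = record
        { F₀ = λ x → s' x , t' x , e x
        ; F₁ = λ {x} {y} f →
            pbhom (SqS.conj (φ x) (φ y) (F₁ (l' c) f)) (SqT.conj (ψ x) (ψ y) (F₁ (r' c) f))
                  (conj-square f)
        ; F-id = λ {x} → PbHom-≡
            (trans (cong (SqS.conj (φ x) (φ x)) (F-id (l' c))) (SqS.conj-id (φ x)))
            (trans (cong (SqT.conj (ψ x) (ψ x)) (F-id (r' c))) (SqT.conj-id (ψ x)))
        ; F-∘ = λ {x} {y} {z} g f → PbHom-≡
            (trans (cong (SqS.conj (φ x) (φ z)) (F-∘ (l' c) g f)) (SqS.conj-∘ (φ x) (φ y) (φ z) _ _))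
            (trans (cong (SqT.conj (ψ x) (ψ z)) (F-∘ (r' c) g f)) (SqT.conj-∘ (ψ x) (ψ y) (ψ z) _ _))
        }

  rectifiable⇒bipullback : Rectifiable u v → IsBipullback u v (pb-l u v) (pb-r u v) (pb-μ u v)
  rectifiable⇒bipullback R X = rectifiable⇒essSurj R X , pullback-full X , pullback-faithful X

  bipullback⇒rectifiable : IsBipullback u v (pb-l u v) (pb-r u v) (pb-μ u v) → Rectifiable u v
  bipullback⇒rectifiable bip s t b =
    rectification _ _ (proj₂ (proj₂ (F₀ h tt))) (η (α m) tt S.⁻¹) (η (β m) tt T.⁻¹)
      (trans (cong (coe B (proj₂ (proj₂ (F₀ h tt))) B.∘_) (F-⁻¹ u _))
        (trans (SqB.square-transpose (eq m tt)) (cong (B._∘ b) (sym (F-⁻¹ v _)))))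
    where
      b-natural : b B.∘ F₁ u S.id ≡ F₁ v T.id B.∘ b
      b-natural = trans (cong (b B.∘_) (F-id u)) (trans (B.idʳ b)
                    (trans (sym (B.idˡ b)) (cong (B._∘ b) (sym (F-id v)))))

      point : Pseudocone u v 𝟙
      point = record { l' = const s ; r' = const t
                     ; ν = record { η = λ _ → b ; nat = λ _ → b-natural } }

      h : Functor 𝟙 (Pullback u v)
      h = proj₁ (proj₁ (bip 𝟙) point)

      m : PseudoconeMor u v (coneOf u v (pb-l u v) (pb-r u v) (pb-μ u v) h) point
      m = proj₂ (proj₁ (bip 𝟙) point)

rectifiable⇒⊥ : ∀ {A} (S T : Prestrategy A) → Rectifiable (∂ S) (∂ T) → S ⊥ T
rectifiable⇒⊥ S T = rectifiable⇒bipullback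

⊥⇒rectifiable : ∀ {A} (S T : Prestrategy A) → S ⊥ T → Rectifiable (∂ S) (∂ T)
⊥⇒rectifiable S T = bipullback⇒rectifiable

rectifiable-sym : ∀ {S B T} {u : Functor S B} {v : Functor T B} → Rectifiable u v → Rectifiable v u
rectifiable-sym {B = B} R t s b with R s t (Groupoid._⁻¹ B b)
... | rectification s' t' e φ ψ sq =
  rectification t' s' (sym e) ψ φ (Squares.coe-square-invert B {p = e} sq)

idF : ∀ {B} → Functor B B
idF = record { F₀ = λ x → x ; F₁ = λ f → f ; F-id = refl ; F-∘ = λ _ _ → refl }

idStrat : (B : Groupoid) → Prestrategy B
idStrat B = prestrategy B idF

rectifiable-idStrat : ∀ {B} (S : Prestrategy B) → Rectifiable (∂ S) (∂ (idStrat B))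
rectifiable-idStrat {B} S s b β =
  rectification s (F₀ (∂ S) s) refl (Groupoid.id (carrier S)) (β B.⁻¹)
    (trans (B.idˡ _) (trans (F-id (∂ S)) (sym (B.invˡ β))))
  where module B = Groupoid B

idStrat-⊥ : ∀ {B} (S : Prestrategy B) → S ⊥ idStrat B
idStrat-⊥ {B} S = rectifiable⇒⊥ S (idStrat B) (rectifiable-idStrat S)

-- S · σ is the composite S ⊙ σ, reading σ as a prestrategy from the
-- terminal groupoid to A.
_·_ : ∀ {A B} → Prestrategy (A ⊗ B) → Prestrategy A → Prestrategy B
S · σ = prestrategy (Pullback (∂ σ) (π₁ ∘F ∂ S)) ((π₂ ∘F ∂ S) ∘F pb-r (∂ σ) (π₁ ∘F ∂ S))

module _ {A B : Groupoid} (S : Prestrategy (A ⊗ B)) (σ : Prestrategy A) (V : Prestrategy B) where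
  private
    module A = Groupoid A
    module B = Groupoid B

  rectifiable-· : Rectifiable (∂ (σ ⊗S V)) (∂ S) → Rectifiable (∂ (S · σ)) (∂ V)
  rectifiable-· R (a , s , eA) v β with R (a , v) s (coe A eA , β B.⁻¹)
  ... | rectification (a' , v') s' e (ψa , ψv) φ sq =
    rectification (a' , s' , cong proj₁ e) v' (sym (cong proj₂ e))
      (pbhom ψa φ (⊗-square₁ {A = A} {B} {e = e} sq)) ψv
      (Squares.coe-square-invert B {p = cong proj₂ e} (⊗-square₂ {A = A} {B} {e = e} sq))

  -- Both groupoids are limits of σ → A ← S → B ← V: m₀ and m₁ reassociate.
  discrete-· : Discrete (PB S (σ ⊗S V)) → Discrete (PB (S · σ) V)
  discrete-· = discrete-transfer m₀ m₁ m₀-injective m₁-reflects-id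
    where
      m₀ : Obj (PB (S · σ) V) → Obj (PB S (σ ⊗S V))
      m₀ ((a , s , eA) , v , eB) = s , (a , v) , cong₂ _,_ (sym eA) eB

      m₁ : ∀ {x y} → Hom (PB (S · σ) V) x y → Hom (PB S (σ ⊗S V)) (m₀ x) (m₀ y)
      m₁ {(_ , _ , eA) , _ , eB} {(_ , _ , eA') , _ , eB'} (pbhom (pbhom φa φs sqA) φv sqB) =
        pbhom φs (φa , φv)
          (⊗-coe-square {A = A} {B} {p = sym eA} {sym eA'} {eB} {eB'}
            (Squares.coe-square-sym A {p = eA} {eA'} sqA) sqB)

      m₀-injective : ∀ {x y} → m₀ x ≡ m₀ y → x ≡ y
      m₀-injective {(_ , _ , _) , _ , _} {(_ , _ , _) , _ , _} q =
        PbObj-≡ {u = ∂ (S · σ)} {v = ∂ V}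
          (PbObj-≡ {u = ∂ σ} {v = π₁ ∘F ∂ S} (cong (λ z → proj₁ (proj₁ (proj₂ z))) q) (cong proj₁ q))
          (cong (λ z → proj₂ (proj₁ (proj₂ z))) q)

      m₁-reflects-id : ∀ {x} (f : Hom (PB (S · σ) V) x x) →
                       m₁ f ≡ Groupoid.id (PB S (σ ⊗S V)) → f ≡ Groupoid.id (PB (S · σ) V)
      m₁-reflects-id (pbhom (pbhom _ _ _) _ _) q =
        PbHom-≡ (PbHom-≡ (cong (λ z → proj₁ (PbHom.hg z)) q) (cong PbHom.hf q))
                (cong (λ z → proj₂ (PbHom.hg z)) q)

module _ {A B C : Groupoid} (S : Prestrategy (A ⊗ B)) (T : Prestrategy (B ⊗ C))
         (σ : Prestrategy A) (W : Prestrategy C) where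
  private
    module A = Groupoid A
    module B = Groupoid B
    module ∣S∣ = Groupoid (carrier S)
    module ∣σ∣ = Groupoid (carrier σ)

  -- Rectify the A-component against S first, leaving B fixed; the result is
  -- an object of S · σ, which is then rectified together with the
  -- C-component against T.
  rectifiable-⊙ : Rectifiable (∂ (σ ⊗S idStrat B)) (∂ S) → Rectifiable (∂ ((S · σ) ⊗S W)) (∂ T) →
                  Rectifiable (∂ (σ ⊗S W)) (∂ (T ⊙ S))
  rectifiable-⊙ R₁ R₂ (a , c) (s , t , eB) (βA , βC)
    with R₁ (a , proj₂ (F₀ (∂ S) s)) s (βA , B.id)
  ... | rectification (a₁ , _) s₁ e₁ (ψa₁ , _) φ₁ sq₁
    with R₂ ((a₁ , s₁ , cong proj₁ e₁) , c) t (coe B eB B.∘ (proj₂ (F₁ (∂ S) φ₁) B.⁻¹) , βC)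
  ... | rectification ((a₂ , s₂ , eA₂) , c₂) t₂ e₂ (pbhom ψa₂ φ₂ sqA₂ , ψc₂) χ sq₂ =
    rectification (a₂ , c₂) (s₂ , t₂ , cong proj₁ e₂) (cong₂ _,_ eA₂ (cong proj₂ e₂))
      (ψa₂ ∣σ∣.∘ ψa₁ , ψc₂) (pbhom (φ₂ ∣S∣.∘ φ₁) χ sqB)
      (⊗-square {A = A} {C} {p = eA₂} {cong proj₂ e₂} sqA (⊗-square₂ {A = B} {C} {e = e₂} sq₂))
    where
      sqB : coe B (cong proj₁ e₂) B.∘ proj₂ (F₁ (∂ S) (φ₂ ∣S∣.∘ φ₁)) ≡ proj₁ (F₁ (∂ T) χ) B.∘ coe B eB
      sqB = trans (cong (λ w → coe B (cong proj₁ e₂) B.∘ proj₂ w) (F-∘ (∂ S) φ₂ φ₁))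
                  (Squares.square-cancel-inv B (⊗-square₁ {A = B} {C} {e = e₂} sq₂))

      sqA : coe A eA₂ A.∘ F₁ (∂ σ) (ψa₂ ∣σ∣.∘ ψa₁) ≡ proj₁ (F₁ (∂ S) (φ₂ ∣S∣.∘ φ₁)) A.∘ βA
      sqA = trans (cong (coe A eA₂ A.∘_) (F-∘ (∂ σ) ψa₂ ψa₁))
              (trans (Squares.square-paste A (⊗-square₁ {A = A} {B} {e = e₁} sq₁) sqA₂)
                (cong (λ w → proj₁ w A.∘ βA) (sym (F-∘ (∂ S) φ₂ φ₁))))

  discrete-⊙ : Discrete (PB T ((S · σ) ⊗S W)) → Discrete (PB (T ⊙ S) (σ ⊗S W))
  discrete-⊙ = discrete-transfer m₀ m₁ m₀-injective m₁-reflects-id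
    where
      m₀ : Obj (PB (T ⊙ S) (σ ⊗S W)) → Obj (PB T ((S · σ) ⊗S W))
      m₀ ((s , t , eB) , (a , c) , eAC) =
        t , ((a , s , sym (cong proj₁ eAC)) , c) , cong₂ _,_ (sym eB) (cong proj₂ eAC)

      m₁ : ∀ {x y} → Hom (PB (T ⊙ S) (σ ⊗S W)) x y → Hom (PB T ((S · σ) ⊗S W)) (m₀ x) (m₀ y)
      m₁ {(_ , _ , eB) , _ , eAC} {(_ , _ , eB') , _ , eAC'} (pbhom (pbhom φs φt sqB) (φa , φc) sqAC) =
        pbhom φt
          (pbhom φa φs (Squares.coe-square-sym A {p = cong proj₁ eAC} {cong proj₁ eAC'}
                         (⊗-coe-square₁ {A = A} {C} {e = eAC} {eAC'} sqAC)) , φc)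
          (⊗-coe-square {A = B} {C} {p = sym eB} {sym eB'} {cong proj₂ eAC} {cong proj₂ eAC'}
            (Squares.coe-square-sym B {p = eB} {eB'} sqB)
            (⊗-coe-square₂ {A = A} {C} {e = eAC} {eAC'} sqAC))

      m₀-injective : ∀ {x y} → m₀ x ≡ m₀ y → x ≡ y
      m₀-injective {(_ , _ , _) , _ , _} {(_ , _ , _) , _ , _} q =
        PbObj-≡ {u = ∂ (T ⊙ S)} {v = ∂ (σ ⊗S W)}
          (PbObj-≡ {u = π₂ ∘F ∂ S} {v = π₁ ∘F ∂ T}
            (cong (λ z → proj₁ (proj₂ (proj₁ (proj₁ (proj₂ z))))) q) (cong proj₁ q))
          (cong₂ _,_ (cong (λ z → proj₁ (proj₁ (proj₁ (proj₂ z)))) q)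
                     (cong (λ z → proj₂ (proj₁ (proj₂ z))) q))

      m₁-reflects-id : ∀ {x} (f : Hom (PB (T ⊙ S) (σ ⊗S W)) x x) →
                       m₁ f ≡ Groupoid.id (PB T ((S · σ) ⊗S W)) → f ≡ Groupoid.id (PB (T ⊙ S) (σ ⊗S W))
      m₁-reflects-id (pbhom (pbhom _ _ _) _ _) q =
        PbHom-≡ (PbHom-≡ (cong (λ z → PbHom.hg (proj₁ (PbHom.hg z))) q) (cong PbHom.hf q))
                (cong₂ _,_ (cong (λ z → PbHom.hf (proj₁ (PbHom.hg z))) q)
                           (cong (λ z → proj₂ (PbHom.hg z)) q))

-- The groupoid arguments of _·_ and of the lemmas about it are passed
-- explicitly below: inferring them from S : Prestrategy (A ⊗ B) solves the
-- metavariables by eta-expanding A ⊗ B, which makes the subsequent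
-- conversion checks prohibitively slow.
module _ (A B : Thin) (S : Prestrategy (Thin.G A ⊗ Thin.G B)) where
  ·-∈U : U⊸ A B S → ∀ σ → Thin.U A σ → Thin.U B (S · σ)
  ·-∈U S∈U⊸ σ σ∈U = Thin.U-⊥⊥ B (_·_ {Thin.G A} {Thin.G B} S σ) λ V V∈U⊥ →
    rectifiable⇒⊥ V (_·_ {Thin.G A} {Thin.G B} S σ) (rectifiable-sym
      (rectifiable-· {Thin.G A} {Thin.G B} S σ V (⊥⇒rectifiable (σ ⊗S V) S (S∈U⊸ σ σ∈U V V∈U⊥))))

  ·-∈𝐓 : T⊸ A B S → ∀ σ → Thin.𝐓 A σ → Thin.𝐓 B (S · σ)
  ·-∈𝐓 (S∈U⊸ , S-discrete) σ σ∈𝐓 = Thin.𝐓-⊥⊥ B (_·_ {Thin.G A} {Thin.G B} S σ)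
    ( ·-∈U S∈U⊸ σ (Thin.𝐓⊆U A σ σ∈𝐓)
    , λ V V∈𝐓⊥ → discrete-· {Thin.G A} {Thin.G B} S σ V (S-discrete σ σ∈𝐓 V V∈𝐓⊥))

module _ (A B C : Thin) (S : Prestrategy (Thin.G A ⊗ Thin.G B)) (T : Prestrategy (Thin.G B ⊗ Thin.G C)) where
  ⊙-∈U⊸ : U⊸ A B S → U⊸ B C T → U⊸ A C (T ⊙ S)
  ⊙-∈U⊸ S∈U⊸ T∈U⊸ σ σ∈U W W∈U⊥ =
    rectifiable⇒⊥ (σ ⊗S W) (T ⊙ S) (rectifiable-⊙ {Thin.G A} {Thin.G B} {Thin.G C} S T σ W
      (⊥⇒rectifiable (σ ⊗S idStrat (Thin.G B)) S
        (S∈U⊸ σ σ∈U (idStrat (Thin.G B)) (λ V _ → idStrat-⊥ V)))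
      (⊥⇒rectifiable ((_·_ {Thin.G A} {Thin.G B} S σ) ⊗S W) T
        (T∈U⊸ (_·_ {Thin.G A} {Thin.G B} S σ) (·-∈U A B S S∈U⊸ σ σ∈U) W W∈U⊥)))

proposition11 : (A B C : Thin) (S : Prestrategy (Thin.G A ⊗ Thin.G B)) (T : Prestrategy (Thin.G B ⊗ Thin.G C)) →
    T⊸ A B S → T⊸ B C T → T⊸ A C (T ⊙ S)
proposition11 A B C S T S∈𝐓⊸ (T∈U⊸ , T-discrete) =
    ⊙-∈U⊸ A B C S T (proj₁ S∈𝐓⊸) T∈U⊸
  , λ σ σ∈𝐓 W W∈𝐓⊥ → discrete-⊙ {Thin.G A} {Thin.G B} {Thin.G C} S T σ W
      (T-discrete (_·_ {Thin.G A} {Thin.G B} S σ) (·-∈𝐓 A B S S∈𝐓⊸ σ σ∈𝐓) W W∈𝐓⊥)
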